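{- For every integer $r \geq 4$ there exists $n_0 = n_0(r)$ such that the following holds for every $n \geq n_0$. Let $G$ be a graph on $n$ vertices with $\delta(G) \geq \lfloor n/2 \rfloor + (r-3)$. If there is a set $A \subseteq V(G)$ with $|A| = \lfloor n/2 \rfloor$ and $\langle A \rangle_r = A$, then $m(G, r) = r$.
   Context: Graphs are finite and simple; $\delta(G)$ is the minimum degree and $N(v)$ the neighbourhood of $v$. For an integer $r \geq 2$, the $r$-neighbour bootstrap process on $G$ started from $A \subseteq V(G)$ is defined by $A_0 = A$ and $A_t = A_{t-1} \cup \{v \in V(G) : |N(v) \cap A_{t-1}| \geq r\}$ for $t \geq 1$. The closure is $\langle A \rangle_r = \bigcup_{t \geq 0} A_t$. The set $A$ percolates if $\langle A \rangle_r = V(G)$. Define $m(G,r) = \min\{|A| : A \subseteq V(G),\ \langle A \rangle_r = V(G)\}$. -}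

module Defs where

open import Data.Nat using (ℕ; zero; suc; _≤_; _≤ᵇ_)
open import Data.Bool using (Bool; true; false)
open import Data.Fin using (Fin)
open import Data.Fin.Subset using (Subset; _∈_; _∩_; _∪_; ∣_∣)
open import Data.Vec using (tabulate)
open import Data.Product using (Σ; ∃; _×_)
open import Relation.Binary.PropositionalEquality using (_≡_)
open import Relation.Nullary using (¬_)

record Graph (n : ℕ) : Set where
  field
    adj   : Fin n → Fin n → Bool
    sym   : ∀ u v → adj u v ≡ adj v u
    irrefl : ∀ v → adj v v ≡ false
open Graph public

module _ {n : ℕ} (G : Graph n) where

  N : Fin n → Subset n
  N v = tabulate (adj G v)

  degree : Fin n → ℕ
  degree v = ∣ N v ∣

  MinDegreeAtLeast : ℕ → Set
  MinDegreeAtLeast d = ∀ v → d ≤ degree v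

  step : ℕ → Subset n → Subset n
  step r A = A ∪ tabulate (λ v → r ≤ᵇ ∣ N v ∩ A ∣)

  stage : ℕ → Subset n → ℕ → Subset n
  stage r A zero    = A
  stage r A (suc t) = step r (stage r A t)

  _∈Closure[_]_ : Fin n → ℕ → Subset n → Set
  v ∈Closure[ r ] A = ∃ λ t → v ∈ stage r A t

  -- ⟨A⟩_r = A  (the inclusion A ⊆ ⟨A⟩_r holds always, via t = 0;
  -- we state both inclusions explicitly)
  ClosureEq : ℕ → Subset n → Set
  ClosureEq r A = (∀ v → v ∈Closure[ r ] A → v ∈ A) × (∀ v → v ∈ A → v ∈Closure[ r ] A)

  Percolates : ℕ → Subset n → Set
  Percolates r A = ∀ v → v ∈Closure[ r ] A

  MEquals : ℕ → ℕ → Set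
  MEquals r k = (∃ λ A → ∣ A ∣ ≡ k × Percolates r A) × (∀ A → Percolates r A → k ≤ ∣ A ∣)

-- Let h = ⌊n/2⌋, r = k + 4 and B the complement of the closed set A, so |B| ∈ {h, h + 1}. Closedness says every
-- vertex of B has at most r - 1 neighbours in A; with δ(G) ≥ h + r - 3 this makes B almost complete (a vertex of B
-- misses at most 3 vertices of B) and gives every vertex of A at least r - 2 neighbours in B. Split A into the set W
-- of vertices with at least r neighbours in B and the rest A′, whose vertices miss at most 2 vertices of A.
--
-- If |W| ≥ 3, seed r common neighbours of a triangle b₁b₂b₃ in B: the triangle, then B, then W, then A′ get infected.
-- If |W| ≤ 2, double counting the edges between A′ and B gives t₁ ∈ A′ with two neighbours b₁, b₂ in B that each have
-- two neighbours in A′, then t₂ ∈ A′ adjacent to two of t₁, b₁, b₂, and t₃ ∈ A′ adjacent to t₁ and t₂. Seeding b₁, b₂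
-- and r - 2 common neighbours of t₁, t₂, t₃ in A′ infects t₁, t₂, t₃, then A′, then the (by double counting, many)
-- common neighbours of b₁ and b₂ having r - 2 neighbours in A′, then B, and finally W.
--
-- Conversely a set of fewer than r vertices is already closed, so it percolates only if it is everything.

module Submission where

open import Defs
open import Data.Nat using (ℕ; _≤_; _+_; _∸_)
open import Data.Nat.DivMod using (_/_)
open import Data.Fin.Subset using (Subset; ∣_∣)
open import Data.Product using (Σ; ∃; _×_)
open import Relation.Binary.PropositionalEquality using (_≡_)

open import Data.Bool using (Bool; true; false; _∧_; _∨_; not)
open import Data.Bool.Properties using (∧-comm; ∧-conicalˡ; ∧-conicalʳ; ∧-distribʳ-∨; ∨-identityʳ; ∨-zeroʳ; T-≡)
open import Data.Empty using (⊥)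
open import Data.Fin using (Fin; zero; suc; _≟_)
open import Data.Fin.Subset using () renaming (_∩_ to _∩ₛ_)
open import Data.Nat using (zero; suc; _*_; _<_; _≤ᵇ_; z≤n; s≤s; _<?_; _≤?_)
open import Data.Nat.DivMod using (_%_; m≡m%n+[m/n]*n; m%n<n; m*n/n≡m; /-monoˡ-≤)
open import Data.Nat.Properties hiding (_≟_)
open import Algebra.Properties.Semiring.Sum +-*-semiring
  using (sum; sum-cong-≗; sum-replicate-zero; ∑-distrib-+; ∑-comm; *-distribˡ-sum; *-distribʳ-sum)
open import Data.Nat.Tactic.RingSolver using (solve-∀)
open import Data.Product using (_,_; proj₁; proj₂)
open import Data.Sum using (_⊎_; inj₁; inj₂; [_,_])
open import Data.Vec using ([]; _∷_; lookup; tabulate)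
open import Data.Vec.Properties using (lookup∘tabulate; tabulate∘lookup; lookup-zipWith; []=⇒lookup; lookup⇒[]=)
open import Function using (_∘_)
open import Function.Bundles using (Equivalence)
open import Relation.Binary.PropositionalEquality as ≡
  using (refl; trans; cong; cong₂; subst; subst₂; module ≡-Reasoning)
open import Relation.Nullary using (¬_; Dec; yes; no; does; contradiction)
open import Relation.Nullary.Decidable using (dec-true; dec-false)

-- Vertex sets

VSet : ℕ → Set
VSet n = Fin n → Bool

module _ {n : ℕ} where

  infix 4 _∈_ _∉_ _⊆_
  infixl 7 _∩_ _∖_
  infixl 6 _∪_

  -- A record rather than X i ≡ true, so that X can be recovered from the type i ∈ X by unification.
  record _∈_ (i : Fin n) (X : VSet n) : Set where
    constructor mem
    field is-true : X i ≡ true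
  open _∈_ public

  _∩_ _∪_ : VSet n → VSet n → VSet n
  (X ∩ Y) i = X i ∧ Y i
  (X ∪ Y) i = X i ∨ Y i

  ∁ : VSet n → VSet n
  ∁ X i = not (X i)

  _∉_ : Fin n → VSet n → Set
  i ∉ X = i ∈ ∁ X

  All : (Fin n → Set) → VSet n → Set
  All Q X = ∀ i → i ∈ X → Q i

  _⊆_ : VSet n → VSet n → Set
  X ⊆ Y = All (_∈ Y) X

  Disjoint : VSet n → VSet n → Set
  Disjoint X Y = All (_∉ X) Y

  setOf : {P : Fin n → Set} → (∀ i → Dec (P i)) → VSet n
  setOf P? i = does (P? i)

  ⁅_⁆ : Fin n → VSet n
  ⁅ v ⁆ = setOf (_≟ v)

  _∖_ : VSet n → Fin n → VSet n
  X ∖ v = X ∩ ∁ ⁅ v ⁆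

  ∉⇒false : ∀ {X i} → i ∉ X → X i ≡ false
  ∉⇒false {X} {i} (mem p) with X i
  ... | false = refl

  ∈⇒∉⇒⊥ : ∀ {X i} → i ∈ X → i ∉ X → ⊥
  ∈⇒∉⇒⊥ {X} {i} (mem p) (mem q) with X i
  ∈⇒∉⇒⊥ (mem ()) (mem q) | false
  ∈⇒∉⇒⊥ (mem p) (mem ()) | true

  ¬∈⇒∉ : ∀ {X i} → ¬ i ∈ X → i ∉ X
  ¬∈⇒∉ {X} {i} i∉X with X i in eq
  ... | true  = contradiction (mem eq) i∉X
  ... | false = mem (cong not eq)

  setOf⁺ : ∀ {P : Fin n → Set} (P? : ∀ i → Dec (P i)) {i} → P i → i ∈ setOf P?
  setOf⁺ P? {i} p = mem (dec-true (P? i) p)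

  setOf⁻ : ∀ {P : Fin n → Set} (P? : ∀ i → Dec (P i)) {i} → i ∈ setOf P? → P i
  setOf⁻ P? {i} (mem i∈) with P? i
  ... | yes p = p

  setOf-∉ : ∀ {P : Fin n → Set} (P? : ∀ i → Dec (P i)) {i} → ¬ P i → i ∉ setOf P?
  setOf-∉ P? {i} ¬p = mem (cong not (dec-false (P? i) ¬p))

  setOf-∉⁻ : ∀ {P : Fin n → Set} (P? : ∀ i → Dec (P i)) {i} → i ∉ setOf P? → ¬ P i
  setOf-∉⁻ P? i∉ p = ∈⇒∉⇒⊥ (setOf⁺ P? p) i∉

  ∪⁺ˡ : ∀ {X Y i} → i ∈ X → i ∈ X ∪ Y
  ∪⁺ˡ (mem p) = mem (cong (_∨ _) p)

  ∪⁺ʳ : ∀ {X Y i} → i ∈ Y → i ∈ X ∪ Y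
  ∪⁺ʳ {X} {Y} {i} (mem p) = mem (trans (cong (X i ∨_) p) (∨-zeroʳ (X i)))

  ∩⁺ : ∀ {X Y i} → i ∈ X → i ∈ Y → i ∈ X ∩ Y
  ∩⁺ {X} {Y} {i} (mem p) (mem q) = mem (cong₂ _∧_ p q)

  ∩⁻ˡ : ∀ {X Y i} → i ∈ X ∩ Y → i ∈ X
  ∩⁻ˡ {X} {Y} {i} (mem p) = mem (∧-conicalˡ (X i) (Y i) p)

  ∩⁻ʳ : ∀ {X Y i} → i ∈ X ∩ Y → i ∈ Y
  ∩⁻ʳ {X} {Y} {i} (mem p) = mem (∧-conicalʳ (X i) (Y i) p)

  ∩-monoˡ : ∀ {X Y Z} → X ⊆ Y → X ∩ Z ⊆ Y ∩ Z
  ∩-monoˡ X⊆Y i i∈ = ∩⁺ (X⊆Y i (∩⁻ˡ i∈)) (∩⁻ʳ i∈)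

  ∪⁻ : ∀ {X Y i} → i ∈ X ∪ Y → i ∈ X ⊎ i ∈ Y
  ∪⁻ {X} {Y} {i} (mem p) with X i in eq
  ... | true  = inj₁ (mem eq)
  ... | false = inj₂ (mem p)

  ∈⁅⁆⁻ : ∀ {v i} → i ∈ ⁅ v ⁆ → i ≡ v
  ∈⁅⁆⁻ {v} = setOf⁻ (_≟ v)

  ∈⇒∉⇒∉⁅⁆ : ∀ {X u v} → u ∈ X → v ∉ X → u ∉ ⁅ v ⁆
  ∈⇒∉⇒∉⁅⁆ {v = v} u∈X v∉X = setOf-∉ (_≟ v) λ { refl → ∈⇒∉⇒⊥ u∈X v∉X }

  ∈⇒∉∁ : ∀ {X i} → i ∈ X → i ∉ ∁ X
  ∈⇒∉∁ (mem p) = mem (cong (not ∘ not) p)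

  ∉-∪ : ∀ {X Y i} → i ∉ X → i ∉ Y → i ∉ X ∪ Y
  ∉-∪ i∉X i∉Y = mem (cong₂ (λ a b → not (a ∨ b)) (∉⇒false i∉X) (∉⇒false i∉Y))

  All-∪ : ∀ {Q X Y} → All Q X → All Q Y → All Q (X ∪ Y)
  All-∪ QX QY i i∈ = [ QX i , QY i ] (∪⁻ i∈)

  All-⁅⁆ : ∀ {Q v} → Q v → All Q ⁅ v ⁆
  All-⁅⁆ {Q} Qv i i∈ = subst Q (≡.sym (∈⁅⁆⁻ i∈)) Qv

  All-∪⁅⁆ : ∀ {Q X v} → All Q X → Q v → All Q (X ∪ ⁅ v ⁆)
  All-∪⁅⁆ QX Qv = All-∪ QX (All-⁅⁆ Qv)

-- Counting

𝟙 : Bool → ℕ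
𝟙 true  = 1
𝟙 false = 0

𝟙≤1 : ∀ b → 𝟙 b ≤ 1
𝟙≤1 true  = ≤-refl
𝟙≤1 false = z≤n

sum-mono-≤ : ∀ {m} {f g : Fin m → ℕ} → (∀ i → f i ≤ g i) → sum f ≤ sum g
sum-mono-≤ {zero}  f≤g = z≤n
sum-mono-≤ {suc m} f≤g = +-mono-≤ (f≤g zero) (sum-mono-≤ (f≤g ∘ suc))

sum<⇒∃< : ∀ {m} (f g : Fin m → ℕ) → sum f < sum g → ∃ λ i → f i < g i
sum<⇒∃< {suc m} f g Σf<Σg with f zero <? g zero
... | yes f₀<g₀ = zero , f₀<g₀
... | no  f₀≮g₀ = let i , fᵢ<gᵢ = sum<⇒∃< (f ∘ suc) (g ∘ suc) Σf′<Σg′ in suc i , fᵢ<gᵢ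
  where
  Σf′<Σg′ : sum (f ∘ suc) < sum (g ∘ suc)
  Σf′<Σg′ = +-cancelˡ-< (g zero) _ _ (≤-<-trans (+-monoˡ-≤ (sum (f ∘ suc)) (≮⇒≥ f₀≮g₀)) Σf<Σg)

count : ∀ {n} → VSet n → ℕ
count X = sum (λ i → 𝟙 (X i))

𝟙-∧ : ∀ a b → 𝟙 (a ∧ b) ≡ 𝟙 a * 𝟙 b
𝟙-∧ true  b = ≡.sym (+-identityʳ (𝟙 b))
𝟙-∧ false b = refl

𝟙-split : ∀ a b → 𝟙 a ≡ 𝟙 (a ∧ b) + 𝟙 (a ∧ not b)
𝟙-split true  true  = refl
𝟙-split true  false = refl
𝟙-split false b     = refl

𝟙-∨ : ∀ a b → (b ≡ true → a ≡ false) → 𝟙 (a ∨ b) ≡ 𝟙 a + 𝟙 b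
𝟙-∨ a     false _   = trans (cong 𝟙 (∨-identityʳ a)) (≡.sym (+-identityʳ (𝟙 a)))
𝟙-∨ a     true  b⇒¬a rewrite b⇒¬a refl = refl

sum-⁅⁆ : ∀ {n} (f : Fin n → ℕ) v → sum (λ i → 𝟙 (⁅ v ⁆ i) * f i) ≡ f v
sum-⁅⁆ {suc n} f zero    = trans (cong₂ _+_ (+-identityʳ (f zero)) (sum-replicate-zero n)) (+-identityʳ (f zero))
sum-⁅⁆ {suc n} f (suc v) = sum-⁅⁆ (f ∘ suc) v

count-∩⁅⁆ : ∀ {n} (X : VSet n) v → count (X ∩ ⁅ v ⁆) ≡ 𝟙 (X v)
count-∩⁅⁆ X v =
  trans (sum-cong-≗ λ i → trans (𝟙-∧ (X i) (⁅ v ⁆ i)) (*-comm (𝟙 (X i)) _)) (sum-⁅⁆ (λ i → 𝟙 (X i)) v)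

∣p∣≡count : ∀ {n} (p : Subset n) → ∣ p ∣ ≡ count (lookup p)
∣p∣≡count []          = refl
∣p∣≡count (true  ∷ p) = cong suc (∣p∣≡count p)
∣p∣≡count (false ∷ p) = ∣p∣≡count p

count-all : ∀ {n} {X : VSet n} → (∀ i → i ∈ X) → count X ≡ n
count-all {zero}      all = refl
count-all {suc n} {X} all rewrite is-true (all zero) =
  cong suc (count-all (λ i → mem (is-true (all (suc i)))))

∃⊆-count : ∀ {n} {X : VSet n} m → m ≤ count X → ∃ λ S → S ⊆ X × count S ≡ m
∃⊆-count {n} zero _ = (λ _ → false) , (λ _ ()) , sum-replicate-zero n
∃⊆-count {suc n} {X} (suc m) m<∣X∣ with X zero in eq
... | true with ∃⊆-count {X = X ∘ suc} m (≤-pred m<∣X∣)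
...   | S , S⊆ , ∣S∣ = S′ , S′⊆ , cong suc ∣S∣
  where
  S′ : VSet (suc n)
  S′ zero    = true
  S′ (suc i) = S i
  S′⊆ : S′ ⊆ X
  S′⊆ zero    _  = mem eq
  S′⊆ (suc i) i∈ = mem (is-true (S⊆ i (mem (is-true i∈))))
∃⊆-count {suc n} {X} (suc m) m<∣X∣ | false with ∃⊆-count {X = X ∘ suc} (suc m) m<∣X∣
...   | S , S⊆ , ∣S∣ = S′ , S′⊆ , ∣S∣
  where
  S′ : VSet (suc n)
  S′ zero    = false
  S′ (suc i) = S i
  S′⊆ : S′ ⊆ X
  S′⊆ zero    (mem ())
  S′⊆ (suc i) i∈ = mem (is-true (S⊆ i (mem (is-true i∈))))

module _ {n : ℕ} where

  count-cong : ∀ {X Y : VSet n} → (∀ i → X i ≡ Y i) → count X ≡ count Y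
  count-cong X≗Y = sum-cong-≗ (cong 𝟙 ∘ X≗Y)

  count-mono : ∀ {X Y : VSet n} → X ⊆ Y → count X ≤ count Y
  count-mono {X} {Y} X⊆Y = sum-mono-≤ pointwise
    where
    pointwise : ∀ i → 𝟙 (X i) ≤ 𝟙 (Y i)
    pointwise i with X i in eq
    ... | false = z≤n
    ... | true  rewrite is-true (X⊆Y i (mem eq)) = ≤-refl

  count-split : ∀ (X Y : VSet n) → count X ≡ count (X ∩ Y) + count (X ∩ ∁ Y)
  count-split X Y =
    trans (sum-cong-≗ λ i → 𝟙-split (X i) (Y i)) (∑-distrib-+ (λ i → 𝟙 ((X ∩ Y) i)) (λ i → 𝟙 ((X ∩ ∁ Y) i)))

  count-∪ : ∀ {X Y : VSet n} → Disjoint X Y → count (X ∪ Y) ≡ count X + count Y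
  count-∪ {X} {Y} X∩Y≡∅ =
    trans (sum-cong-≗ λ i → 𝟙-∨ (X i) (Y i) (λ eq → ∉⇒false (X∩Y≡∅ i (mem eq))))
          (∑-distrib-+ (λ i → 𝟙 (X i)) (λ i → 𝟙 (Y i)))

  count-⁅⁆ : ∀ v → count ⁅ v ⁆ ≡ 1
  count-⁅⁆ v = count-∩⁅⁆ {n} (λ _ → true) v

  count-∪⁅⁆ : ∀ {X : VSet n} {v} → v ∉ X → count (X ∪ ⁅ v ⁆) ≡ count X + 1
  count-∪⁅⁆ {X} {v} v∉X = trans (count-∪ (All-⁅⁆ v∉X)) (cong (count X +_) (count-⁅⁆ v))

  count-∖ : ∀ {X : VSet n} {v} → v ∈ X → suc (count (X ∖ v)) ≡ count X
  count-∖ {X} {v} v∈X = begin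
    suc (count (X ∖ v))                      ≡⟨ cong (_+ count (X ∖ v)) (cong 𝟙 (is-true v∈X)) ⟨
    𝟙 (X v) + count (X ∖ v)                  ≡⟨ cong (_+ count (X ∖ v)) (count-∩⁅⁆ X v) ⟨
    count (X ∩ ⁅ v ⁆) + count (X ∩ ∁ ⁅ v ⁆)  ≡⟨ count-split X ⁅ v ⁆ ⟨
    count X                                  ∎
    where open ≡-Reasoning

  count>0⇒∃ : ∀ {X : VSet n} → 0 < count X → ∃ (_∈ X)
  count>0⇒∃ {X} 0<∣X∣ with sum<⇒∃< (λ _ → 0) (λ i → 𝟙 (X i)) (subst (_< count X) (≡.sym (sum-replicate-zero n)) 0<∣X∣)
  ... | i , 0<𝟙Xᵢ with X i in eq
  ...   | true = i , mem eq

-- Degrees and edges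

module Degrees {n : ℕ} (G : Graph n) where

  Γ : Fin n → VSet n
  Γ = adj G

  -- nondeg X v counts v itself whenever v ∈ X.
  deg nondeg : VSet n → Fin n → ℕ
  deg X v = count (X ∩ Γ v)
  nondeg X v = count (X ∩ ∁ (Γ v))

  Γ-sym : ∀ {u v} → u ∈ Γ v → v ∈ Γ u
  Γ-sym {u} {v} (mem p) = mem (trans (sym G u v) p)

  v∉Γv : ∀ v → v ∉ Γ v
  v∉Γv v = mem (cong not (irrefl G v))

  ⊆Γ⇒∉ : ∀ {X v} → X ⊆ Γ v → v ∉ X
  ⊆Γ⇒∉ {v = v} X⊆Γv = ¬∈⇒∉ λ v∈X → ∈⇒∉⇒⊥ (X⊆Γv v v∈X) (v∉Γv v)

  count≡deg+nondeg : ∀ X v → count X ≡ deg X v + nondeg X v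
  count≡deg+nondeg X v = count-split X (Γ v)

  count≤deg+nondeg : ∀ {X Y v} → X ⊆ Y → count X ≤ deg X v + nondeg Y v
  count≤deg+nondeg {X} {Y} {v} X⊆Y =
    subst (_≤ deg X v + nondeg Y v) (≡.sym (count≡deg+nondeg X v))
          (+-monoʳ-≤ (deg X v) (count-mono (∩-monoˡ X⊆Y)))

  nondeg-self : ∀ {X Y v} → X ⊆ Y → v ∉ X → v ∈ Y → suc (nondeg X v) ≤ nondeg Y v
  nondeg-self {X} {Y} {v} X⊆Y v∉X v∈Y = begin
    suc (nondeg X v)                        ≡⟨ +-comm 1 (nondeg X v) ⟩
    nondeg X v + 1                          ≡⟨ cong (nondeg X v +_) (count-⁅⁆ v) ⟨
    nondeg X v + count ⁅ v ⁆                ≡⟨ ≡.sym (count-∪ (All-⁅⁆ v∉X∩∁Γv)) ⟩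
    count (X ∩ ∁ (Γ v) ∪ ⁅ v ⁆)             ≤⟨ count-mono (All-∪⁅⁆ (∩-monoˡ X⊆Y) (∩⁺ v∈Y (v∉Γv v))) ⟩
    nondeg Y v                              ∎
    where
    open ≤-Reasoning
    v∉X∩∁Γv : v ∉ X ∩ ∁ (Γ v)
    v∉X∩∁Γv = ¬∈⇒∉ λ v∈ → ∈⇒∉⇒⊥ (∩⁻ˡ v∈) v∉X

  deg≤count : ∀ X v → deg X v ≤ count X
  deg≤count X v = count-mono {X = X ∩ Γ v} {Y = X} λ i → ∩⁻ˡ

  count≤deg : ∀ {X v} → X ⊆ Γ v → count X ≤ deg X v
  count≤deg X⊆Γv = count-mono λ i i∈X → ∩⁺ i∈X (X⊆Γv i i∈X)

  deg-mono : ∀ {X Y v} → X ⊆ Y → deg X v ≤ deg Y v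
  deg-mono X⊆Y = count-mono (∩-monoˡ X⊆Y)

  deg-∪ : ∀ {X Y v} → Disjoint X Y → deg (X ∪ Y) v ≡ deg X v + deg Y v
  deg-∪ {X} {Y} {v} X∩Y≡∅ =
    trans (count-cong λ i → ∧-distribʳ-∨ (Γ v i) (X i) (Y i))
          (count-∪ λ i i∈ → ¬∈⇒∉ λ i∈X∩Γ → ∈⇒∉⇒⊥ (∩⁻ˡ i∈X∩Γ) (X∩Y≡∅ i (∩⁻ˡ i∈)))

  deg-∖ : ∀ X u v → deg X v ≤ deg (X ∖ u) v + 𝟙 (Γ v u)
  deg-∖ X u v = begin
    deg X v                                              ≡⟨ count-split (X ∩ Γ v) ⁅ u ⁆ ⟩
    count (X ∩ Γ v ∩ ⁅ u ⁆) + count (X ∩ Γ v ∩ ∁ ⁅ u ⁆)  ≡⟨ +-comm (count (X ∩ Γ v ∩ ⁅ u ⁆)) _ ⟩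
    count (X ∩ Γ v ∩ ∁ ⁅ u ⁆) + count (X ∩ Γ v ∩ ⁅ u ⁆)  ≡⟨ cong₂ _+_ (count-cong λ i → swap (X i) (Γ v i) _)
                                                                      (count-∩⁅⁆ (X ∩ Γ v) u) ⟩
    deg (X ∖ u) v + 𝟙 (X u ∧ Γ v u)                      ≤⟨ +-monoʳ-≤ (deg (X ∖ u) v) (𝟙-∧≤ʳ (X u) (Γ v u)) ⟩
    deg (X ∖ u) v + 𝟙 (Γ v u)                            ∎
    where
    open ≤-Reasoning
    swap : ∀ a b c → (a ∧ b) ∧ c ≡ (a ∧ c) ∧ b
    swap true  b c = ∧-comm b c
    swap false b c = refl
    𝟙-∧≤ʳ : ∀ a b → 𝟙 (a ∧ b) ≤ 𝟙 b
    𝟙-∧≤ʳ true  b = ≤-refl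
    𝟙-∧≤ʳ false b = z≤n

  deg≤deg-∖+1 : ∀ X u v → deg X v ≤ deg (X ∖ u) v + 1
  deg≤deg-∖+1 X u v = ≤-trans (deg-∖ X u v) (+-monoʳ-≤ (deg (X ∖ u) v) (𝟙≤1 (Γ v u)))

  deg≤deg-∖self : ∀ X v → deg X v ≤ deg (X ∖ v) v
  deg≤deg-∖self X v = ≤-trans (subst (λ b → deg X v ≤ deg (X ∖ v) v + 𝟙 b) (irrefl G v) (deg-∖ X v v))
                              (≤-reflexive (+-identityʳ (deg (X ∖ v) v)))

  ∣N∩∣≡deg : ∀ v (p : Subset n) → ∣ N G v ∩ₛ p ∣ ≡ deg (lookup p) v
  ∣N∩∣≡deg v p = trans (∣p∣≡count (N G v ∩ₛ p)) (count-cong λ i → begin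
    lookup (N G v ∩ₛ p) i  ≡⟨ lookup-zipWith _∧_ i (N G v) p ⟩
    lookup (N G v) i ∧ lookup p i  ≡⟨ cong (_∧ lookup p i) (lookup∘tabulate (Γ v) i) ⟩
    Γ v i ∧ lookup p i  ≡⟨ ∧-comm (Γ v i) (lookup p i) ⟩
    lookup p i ∧ Γ v i  ∎)
    where open ≡-Reasoning

  degree≡deg+deg∁ : ∀ X v → degree G v ≡ deg X v + deg (∁ X) v
  degree≡deg+deg∁ X v = begin
    degree G v                                 ≡⟨ ∣p∣≡count (N G v) ⟩
    count (lookup (tabulate (Γ v)))            ≡⟨ count-cong (lookup∘tabulate (Γ v)) ⟩
    count (Γ v)                                ≡⟨ count-split (Γ v) X ⟩
    count (Γ v ∩ X) + count (Γ v ∩ ∁ X)        ≡⟨ cong₂ _+_ (count-cong λ i → ∧-comm (Γ v i) (X i))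
                                                            (count-cong λ i → ∧-comm (Γ v i) (not (X i))) ⟩
    deg X v + deg (∁ X) v                      ∎
    where open ≡-Reasoning

  edges : VSet n → VSet n → ℕ
  edges X Y = sum (λ x → 𝟙 (X x) * deg Y x)

  edges-comm : ∀ X Y → edges X Y ≡ edges Y X
  edges-comm X Y = begin
    sum (λ a → 𝟙 (X a) * sum (λ b → 𝟙 (Y b ∧ Γ a b)))
      ≡⟨ sum-cong-≗ (λ a → *-distribˡ-sum (𝟙 (X a)) (λ b → 𝟙 (Y b ∧ Γ a b))) ⟩
    sum (λ a → sum (λ b → 𝟙 (X a) * 𝟙 (Y b ∧ Γ a b)))
      ≡⟨ ∑-comm (λ a b → 𝟙 (X a) * 𝟙 (Y b ∧ Γ a b)) ⟩
    sum (λ b → sum (λ a → 𝟙 (X a) * 𝟙 (Y b ∧ Γ a b)))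
      ≡⟨ sum-cong-≗ (λ b → sum-cong-≗ (λ a → pointwise a b)) ⟩
    sum (λ b → sum (λ a → 𝟙 (Y b) * 𝟙 (X a ∧ Γ b a)))
      ≡⟨ sum-cong-≗ (λ b → *-distribˡ-sum (𝟙 (Y b)) (λ a → 𝟙 (X a ∧ Γ b a))) ⟨
    sum (λ b → 𝟙 (Y b) * sum (λ a → 𝟙 (X a ∧ Γ b a)))
      ∎
    where
    open ≡-Reasoning
    pointwise : ∀ a b → 𝟙 (X a) * 𝟙 (Y b ∧ Γ a b) ≡ 𝟙 (Y b) * 𝟙 (X a ∧ Γ b a)
    pointwise a b rewrite sym G a b with X a | Y b
    ... | true  | true  = refl
    ... | true  | false = refl
    ... | false | true  = refl
    ... | false | false = refl

  edges-split : ∀ X Y Z → edges X Y ≡ edges (X ∩ Z) Y + edges (X ∩ ∁ Z) Y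
  edges-split X Y Z =
    trans (sum-cong-≗ pointwise) (∑-distrib-+ (λ x → 𝟙 ((X ∩ Z) x) * deg Y x) (λ x → 𝟙 ((X ∩ ∁ Z) x) * deg Y x))
    where
    pointwise : ∀ x → 𝟙 (X x) * deg Y x ≡ 𝟙 ((X ∩ Z) x) * deg Y x + 𝟙 ((X ∩ ∁ Z) x) * deg Y x
    pointwise x = trans (cong (_* deg Y x) (𝟙-split (X x) (Z x))) (*-distribʳ-+ (deg Y x) (𝟙 ((X ∩ Z) x)) _)

  edges-∪ : ∀ {X Z} Y → Disjoint X Z → edges (X ∪ Z) Y ≡ edges X Y + edges Z Y
  edges-∪ {X} {Z} Y X∩Z≡∅ =
    trans (sum-cong-≗ pointwise) (∑-distrib-+ (λ x → 𝟙 (X x) * deg Y x) (λ x → 𝟙 (Z x) * deg Y x))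
    where
    pointwise : ∀ x → 𝟙 ((X ∪ Z) x) * deg Y x ≡ 𝟙 (X x) * deg Y x + 𝟙 (Z x) * deg Y x
    pointwise x = trans (cong (_* deg Y x) (𝟙-∨ (X x) (Z x) (λ eq → ∉⇒false (X∩Z≡∅ x (mem eq)))))
                        (*-distribʳ-+ (deg Y x) (𝟙 (X x)) _)

  edges-⁅⁆ : ∀ v Y → edges ⁅ v ⁆ Y ≡ deg Y v
  edges-⁅⁆ v Y = sum-⁅⁆ (deg Y) v

  edges≤ : ∀ {X Y m} → All (λ x → deg Y x ≤ m) X → edges X Y ≤ count X * m
  edges≤ {X} {Y} {m} bound =
    subst (edges X Y ≤_) (≡.sym (*-distribʳ-sum m (λ x → 𝟙 (X x)))) (sum-mono-≤ pointwise)
    where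
    pointwise : ∀ x → 𝟙 (X x) * deg Y x ≤ 𝟙 (X x) * m
    pointwise x with X x in eq
    ... | true  = *-monoʳ-≤ 1 (bound x (mem eq))
    ... | false = z≤n

  edges≥ : ∀ {X Y m} → All (λ x → m ≤ deg Y x) X → count X * m ≤ edges X Y
  edges≥ {X} {Y} {m} bound =
    subst (_≤ edges X Y) (≡.sym (*-distribʳ-sum m (λ x → 𝟙 (X x)))) (sum-mono-≤ pointwise)
    where
    pointwise : ∀ x → 𝟙 (X x) * m ≤ 𝟙 (X x) * deg Y x
    pointwise x with X x in eq
    ... | true  = *-monoʳ-≤ 1 (bound x (mem eq))
    ... | false = z≤n

  count<edges⇒∃ : ∀ {X Y} → count X < edges X Y → ∃ λ x → x ∈ X × 2 ≤ deg Y x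
  count<edges⇒∃ {X} {Y} lt with sum<⇒∃< (λ x → 𝟙 (X x)) (λ x → 𝟙 (X x) * deg Y x) lt
  ... | x , 𝟙<𝟙*deg with X x in eq
  ...   | true = x , mem eq , subst (2 ≤_) (+-identityʳ (deg Y x)) 𝟙<𝟙*deg

-- The bootstrap process

module Bootstrap {n : ℕ} (G : Graph n) (r : ℕ) (S : VSet n) where
  open Degrees G

  Infected : ℕ → Fin n → Set
  Infected t v = v ∈ lookup (stage G r (tabulate S) t)

  seed-infected : All (Infected 0) S
  seed-infected i (mem p) = mem (trans (lookup∘tabulate S i) p)

  Aₜ : ℕ → Subset n
  Aₜ = stage G r (tabulate S)

  private
    threshold : ℕ → VSet n
    threshold t v = r ≤ᵇ ∣ N G v ∩ₛ Aₜ t ∣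

    lookup-step : ∀ t v → lookup (Aₜ (suc t)) v ≡ (lookup (Aₜ t) ∪ threshold t) v
    lookup-step t v =
      trans (lookup-zipWith _∨_ v (Aₜ t) _) (cong (lookup (Aₜ t) v ∨_) (lookup∘tabulate (threshold t) v))

  infected-suc⁻ : ∀ {t v} → Infected (suc t) v → Infected t v ⊎ r ≤ deg (lookup (Aₜ t)) v
  infected-suc⁻ {t} {v} (mem p) with ∪⁻ {X = lookup (Aₜ t)} {Y = threshold t} (mem (trans (≡.sym (lookup-step t v)) p))
  ... | inj₁ inf         = inj₁ inf
  ... | inj₂ (mem above) = inj₂ (subst (r ≤_) (∣N∩∣≡deg v (Aₜ t)) (≤ᵇ⇒≤ r _ (Equivalence.from T-≡ above)))

  infected-suc : ∀ {t v} → Infected t v → Infected (suc t) v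
  infected-suc {t} {v} (mem p) = mem (trans (lookup-step t v) (cong (_∨ threshold t v) p))

  infected-mono : ∀ {t t′ v} → t ≤ t′ → Infected t v → Infected t′ v
  infected-mono {t} {t′} {v} t≤t′ inf with m≤n⇒∃[o]m+o≡n t≤t′
  ... | d , refl = later d
    where
    later : ∀ d → Infected (t + d) v
    later zero    = subst (λ s → Infected s v) (≡.sym (+-identityʳ t)) inf
    later (suc d) = subst (λ s → Infected s v) (≡.sym (+-suc t d)) (infected-suc {t + d} (later d))

  infect : ∀ {t X v} → All (Infected t) X → r ≤ deg X v → Infected (suc t) v
  infect {t} {X} {v} X-inf r≤deg = mem (trans (lookup-step t v) (trans (cong (lookup (Aₜ t) v ∨_) above) (∨-zeroʳ _)))
    where
    r≤∣N∩Aₜ∣ : r ≤ ∣ N G v ∩ₛ Aₜ t ∣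
    r≤∣N∩Aₜ∣ = ≤-trans r≤deg (subst (deg X v ≤_) (≡.sym (∣N∩∣≡deg v (Aₜ t))) (deg-mono X-inf))
    above : threshold t v ≡ true
    above = Equivalence.to T-≡ (≤⇒≤ᵇ r≤∣N∩Aₜ∣)

  absorb : ∀ {t X Y v m} → X ⊆ Y → All (Infected t) X → v ∈ Y → nondeg Y v ≤ m → r + m ≤ suc (count X) →
           Infected (suc t) v
  absorb {t} {X} {Y} {v} {m} X⊆Y X-inf v∈Y few big with X v in eq
  ... | true  = infected-suc {t} (X-inf v (mem eq))
  ... | false = infect {t} X-inf (+-cancelʳ-≤ m r (deg X v) (begin
    r + m                       ≤⟨ big ⟩
    suc (count X)               ≡⟨ cong suc (count≡deg+nondeg X v) ⟩
    suc (deg X v + nondeg X v)  ≡⟨ +-suc (deg X v) (nondeg X v) ⟨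
    deg X v + suc (nondeg X v)  ≤⟨ +-monoʳ-≤ (deg X v) (≤-trans (nondeg-self X⊆Y (mem (cong not eq)) v∈Y) few) ⟩
    deg X v + m                 ∎))
    where open ≤-Reasoning

  infected⇒seed : count S < r → ∀ {t v} → Infected t v → v ∈ S
  infected⇒seed small {zero}  {v} (mem p) = mem (trans (≡.sym (lookup∘tabulate S v)) p)
  infected⇒seed small {suc t} {v} inf with infected-suc⁻ {t} inf
  ... | inj₁ inf′  = infected⇒seed small {t} inf′
  ... | inj₂ r≤deg = contradiction (≤-trans r≤deg (≤-trans (deg≤count (lookup (Aₜ t)) v) ∣Aₜ∣≤∣S∣)) (<⇒≱ small)
    where
    ∣Aₜ∣≤∣S∣ : count (lookup (Aₜ t)) ≤ count S
    ∣Aₜ∣≤∣S∣ = count-mono λ i → infected⇒seed small {t}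

  percolates : ∀ {t} → (∀ v → Infected t v) → Percolates G r (tabulate S)
  percolates {t} all v = t , lookup⇒[]= v _ (is-true (all v))

  percolates⇒r≤count : r ≤ n → Percolates G r (tabulate S) → r ≤ count S
  percolates⇒r≤count r≤n perc with r ≤? count S
  ... | yes r≤∣S∣ = r≤∣S∣
  ... | no  r≰∣S∣ = contradiction (≤-trans r≤n (≤-reflexive (≡.sym (count-all seed-everything)))) r≰∣S∣
    where
    seed-everything : ∀ v → v ∈ S
    seed-everything v = infected⇒seed (≰⇒> r≰∣S∣) {proj₁ (perc v)} (mem ([]=⇒lookup (proj₂ (perc v))))

percolating⇒r≤∣P∣ : ∀ {n} (G : Graph n) r → r ≤ n → (P : Subset n) → Percolates G r P → r ≤ ∣ P ∣
percolating⇒r≤∣P∣ G r r≤n P perc =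
  subst (r ≤_) (≡.sym (∣p∣≡count P))
        (percolates⇒r≤count r≤n (subst (Percolates G r) (≡.sym (tabulate∘lookup P)) perc))
  where open Bootstrap G r (lookup P)

-- Arithmetic

half-bounds : ∀ n → n / 2 + n / 2 ≤ n × n ≤ suc (n / 2 + n / 2)
half-bounds n = lower , upper
  where
  open ≤-Reasoning
  double : ∀ m → m * 2 ≡ m + m
  double = solve-∀
  n≡ : n ≡ n % 2 + (n / 2 + n / 2)
  n≡ = trans (m≡m%n+[m/n]*n n 2) (cong (n % 2 +_) (double (n / 2)))
  lower : n / 2 + n / 2 ≤ n
  lower = begin
    n / 2 + n / 2            ≤⟨ m≤n+m _ (n % 2) ⟩
    n % 2 + (n / 2 + n / 2)  ≡⟨ n≡ ⟨
    n                        ∎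
  upper : n ≤ suc (n / 2 + n / 2)
  upper = begin
    n                        ≡⟨ n≡ ⟩
    n % 2 + (n / 2 + n / 2)  ≤⟨ +-monoˡ-≤ _ (≤-pred (m%n<n n 2)) ⟩
    suc (n / 2 + n / 2)      ∎

-- In both bounds a = |A′|, and s and u are the numbers of vertices of B with at least m and fewer than m neighbours
-- in A′ (m = 2 and m = k + 2 respectively), and L the number of edges between A′ and the former; the first
-- hypothesis double counts the edges between A′ and B.
many-edges-into-high-part : ∀ {k a u s L} →
  a * (2 + k) ≤ u + L → u + s ≤ a + 3 → L ≤ s * (3 + k) → 5 * k + 28 ≤ a → a < L
many-edges-into-high-part {k} {a} {u} {s} {L} edges≤ u+s≤ L≤ a≥ with a <? L
... | yes a<L = a<L
... | no  a≮L = contradiction (≤-trans a≥ a≤3k+12) (<⇒≱ 3k+12<5k+28)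
  where
  open ≤-Reasoning
  L≤a : L ≤ a
  L≤a = ≮⇒≥ a≮L
  e₁ : ∀ a k → a * (2 + k) ≡ a + a * (1 + k)
  e₁ = solve-∀
  e₂ : ∀ a k → a + 3 + 3 * (3 + k) ≡ a + (3 * k + 12)
  e₂ = solve-∀
  e₃ : ∀ k → suc (3 * k + 12 + (2 * k + 15)) ≡ 5 * k + 28
  e₃ = solve-∀
  3k+12<5k+28 : 3 * k + 12 < 5 * k + 28
  3k+12<5k+28 = subst (3 * k + 12 <_) (e₃ k) (s≤s (m≤m+n (3 * k + 12) (2 * k + 15)))
  a≤u : a ≤ u
  a≤u = ≤-trans (m≤m*n a (1 + k)) (+-cancelˡ-≤ a _ _ (begin
    a + a * (1 + k)  ≡⟨ e₁ a k ⟨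
    a * (2 + k)      ≤⟨ edges≤ ⟩
    u + L            ≤⟨ +-monoʳ-≤ u L≤a ⟩
    u + a            ≡⟨ +-comm u a ⟩
    a + u            ∎))
  s≤3 : s ≤ 3
  s≤3 = +-cancelˡ-≤ a s 3 (≤-trans (+-monoˡ-≤ s a≤u) u+s≤)
  a≤3k+12 : a ≤ 3 * k + 12
  a≤3k+12 = +-cancelˡ-≤ a _ _ (begin
    a + a                    ≤⟨ +-monoʳ-≤ a (m≤m*n a (1 + k)) ⟩
    a + a * (1 + k)          ≡⟨ e₁ a k ⟨
    a * (2 + k)              ≤⟨ edges≤ ⟩
    u + L                    ≤⟨ +-mono-≤ (≤-trans (m≤m+n u s) u+s≤) (≤-trans L≤ (*-monoˡ-≤ (3 + k) s≤3)) ⟩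
    a + 3 + 3 * (3 + k)      ≡⟨ e₂ a k ⟩
    a + (3 * k + 12)         ∎)

large-high-part : ∀ {k a u s} →
  a * (2 + k) ≤ u * (1 + k) + s * (3 + k) → u + s ≤ a + 3 → 5 * k + 28 ≤ a → k + 12 ≤ s
large-high-part {k} {a} {u} {s} edges≤ u+s≤ a≥ = *-cancelˡ-≤ 2 (begin
  2 * (k + 12)                ≤⟨ ≤-trans (≤-reflexive (e₁ k)) (+-monoʳ-≤ (2 * k) (n≤1+n 24)) ⟩
  2 * k + 25                  ≤⟨ +-cancelʳ-≤ (3 * k + 3) _ _ (begin
    2 * k + 25 + (3 * k + 3)    ≡⟨ e₂ k ⟩
    5 * k + 28                  ≤⟨ a≥ ⟩
    a                           ≤⟨ a≤ ⟩
    3 * (1 + k) + 2 * s         ≡⟨ e₃ k s ⟩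
    2 * s + (3 * k + 3)         ∎) ⟩
  2 * s                       ∎)
  where
  open ≤-Reasoning
  e₁ : ∀ k → 2 * (k + 12) ≡ 2 * k + 24
  e₁ = solve-∀
  e₂ : ∀ k → 2 * k + 25 + (3 * k + 3) ≡ 5 * k + 28
  e₂ = solve-∀
  e₃ : ∀ k s → 3 * (1 + k) + 2 * s ≡ 2 * s + (3 * k + 3)
  e₃ = solve-∀
  e₄ : ∀ a k → a * (2 + k) ≡ a + a * (1 + k)
  e₄ = solve-∀
  e₅ : ∀ u s k → u * (1 + k) + s * (3 + k) ≡ (u + s) * (1 + k) + 2 * s
  e₅ = solve-∀
  e₆ : ∀ a k s → (a + 3) * (1 + k) + 2 * s ≡ 3 * (1 + k) + 2 * s + a * (1 + k)
  e₆ = solve-∀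
  a≤ : a ≤ 3 * (1 + k) + 2 * s
  a≤ = +-cancelʳ-≤ (a * (1 + k)) _ _ (begin
    a + a * (1 + k)                    ≡⟨ e₄ a k ⟨
    a * (2 + k)                        ≤⟨ edges≤ ⟩
    u * (1 + k) + s * (3 + k)          ≡⟨ e₅ u s k ⟩
    (u + s) * (1 + k) + 2 * s          ≤⟨ +-monoˡ-≤ (2 * s) (*-monoˡ-≤ (1 + k) u+s≤) ⟩
    (a + 3) * (1 + k) + 2 * s          ≡⟨ e₆ a k s ⟩
    3 * (1 + k) + 2 * s + a * (1 + k)  ∎)

-- The configuration of the theorem

module ClosedHalf {n : ℕ} (G : Graph n) (k : ℕ) (A : VSet n)
  (mindeg : MinDegreeAtLeast G (n / 2 + suc k))
  (∣A∣≡h : count A ≡ n / 2)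
  (A-closed : ∀ {t v} → Bootstrap.Infected G (4 + k) A t v → v ∈ A)
  (large : 5 * k + 30 ≤ n / 2) where

  open Degrees G

  r h : ℕ
  r = 4 + k
  h = n / 2

  B : VSet n
  B = ∁ A

  h+∣B∣≡n : h + count B ≡ n
  h+∣B∣≡n = begin
    h + count B                                              ≡⟨ cong (_+ count B) ∣A∣≡h ⟨
    count A + count B                                        ≡⟨ count-split (λ _ → true) A ⟨
    count {n} (λ _ → true)                                   ≡⟨ count-all (λ _ → mem refl) ⟩
    n                                                        ∎
    where open ≡-Reasoning

  h≤∣B∣ : h ≤ count B
  h≤∣B∣ = +-cancelˡ-≤ h h (count B) (subst (h + h ≤_) (≡.sym h+∣B∣≡n) (proj₁ (half-bounds n)))

  ∣B∣≤1+h : count B ≤ suc h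
  ∣B∣≤1+h = +-cancelˡ-≤ h (count B) (suc h) (subst₂ _≤_ (≡.sym h+∣B∣≡n) (≡.sym (+-suc h h)) (proj₂ (half-bounds n)))

  h+1+k≤deg : ∀ v → h + suc k ≤ deg A v + deg B v
  h+1+k≤deg v = subst (h + suc k ≤_) (degree≡deg+deg∁ A v) (mindeg v)

  B-deg-A : ∀ {v} → v ∈ B → deg A v ≤ 3 + k
  B-deg-A {v} v∈B with r ≤? deg A v
  ... | no  r≰deg = ≤-pred (≰⇒> r≰deg)
  ... | yes r≤deg = contradiction (A-closed {1} (infect {0} seed-infected r≤deg)) λ v∈A → ∈⇒∉⇒⊥ v∈A v∈B
    where open Bootstrap G r A

  B-deg-B : ∀ {v} → v ∈ B → h ≤ deg B v + 2
  B-deg-B {v} v∈B = +-cancelʳ-≤ (suc k) h (deg B v + 2) (begin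
    h + suc k            ≤⟨ h+1+k≤deg v ⟩
    deg A v + deg B v    ≤⟨ +-monoˡ-≤ (deg B v) (B-deg-A v∈B) ⟩
    3 + k + deg B v      ≡⟨ e (deg B v) k ⟩
    deg B v + 2 + suc k  ∎)
    where
    open ≤-Reasoning
    e : ∀ d k → 3 + k + d ≡ d + 2 + suc k
    e = solve-∀

  B-nondeg : ∀ {v} → v ∈ B → nondeg B v ≤ 3
  B-nondeg {v} v∈B = +-cancelˡ-≤ (deg B v) _ _ (begin
    deg B v + nondeg B v  ≡⟨ count≡deg+nondeg B v ⟨
    count B               ≤⟨ ∣B∣≤1+h ⟩
    suc h                 ≤⟨ s≤s (B-deg-B v∈B) ⟩
    suc (deg B v + 2)     ≡⟨ +-suc (deg B v) 2 ⟨
    deg B v + 3           ∎)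
    where open ≤-Reasoning

  A-deg-B : ∀ {v} → v ∈ A → 2 + k ≤ deg B v
  A-deg-B {v} v∈A = +-cancelˡ-≤ h _ _ (≤-trans h+2+k≤ (+-monoˡ-≤ (deg B v) deg-A<h))
    where
    open ≤-Reasoning
    1≤nondeg : 1 ≤ nondeg A v
    1≤nondeg = subst (_≤ nondeg A v) (count-⁅⁆ v) (count-mono (All-⁅⁆ (∩⁺ v∈A (v∉Γv v))))
    deg-A<h : suc (deg A v) ≤ h
    deg-A<h = begin
      suc (deg A v)         ≡⟨ +-comm 1 (deg A v) ⟩
      deg A v + 1           ≤⟨ +-monoʳ-≤ (deg A v) 1≤nondeg ⟩
      deg A v + nondeg A v  ≡⟨ count≡deg+nondeg A v ⟨
      count A               ≡⟨ ∣A∣≡h ⟩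
      h                     ∎
    h+2+k≤ : h + (2 + k) ≤ suc (deg A v) + deg B v
    h+2+k≤ = subst₂ _≤_ (≡.sym (+-suc h (suc k))) refl (s≤s (h+1+k≤deg v))

  HighB : VSet n
  HighB = setOf (λ v → r ≤? deg B v)

  W A′ : VSet n
  W  = A ∩ HighB
  A′ = A ∩ ∁ HighB

  W⊆A : W ⊆ A
  W⊆A _ = ∩⁻ˡ

  A′⊆A : A′ ⊆ A
  A′⊆A _ = ∩⁻ˡ

  W-deg-B : ∀ {v} → v ∈ W → r ≤ deg B v
  W-deg-B v∈W = setOf⁻ (λ v → r ≤? deg B v) (∩⁻ʳ v∈W)

  A′-deg-B : ∀ {v} → v ∈ A′ → deg B v ≤ 3 + k
  A′-deg-B {v} v∈A′ = ≤-pred (≰⇒> (setOf-∉⁻ (λ v → r ≤? deg B v) (∩⁻ʳ v∈A′)))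

  A′-nondeg : ∀ {v} → v ∈ A′ → nondeg A v ≤ 2
  A′-nondeg {v} v∈A′ = +-cancelˡ-≤ (deg A v) _ _ (+-cancelʳ-≤ (suc k) _ _ (begin
    deg A v + nondeg A v + suc k  ≡⟨ cong (_+ suc k) (trans (≡.sym (count≡deg+nondeg A v)) ∣A∣≡h) ⟩
    h + suc k                     ≤⟨ h+1+k≤deg v ⟩
    deg A v + deg B v             ≤⟨ +-monoʳ-≤ (deg A v) (A′-deg-B v∈A′) ⟩
    deg A v + (3 + k)             ≡⟨ +-assoc (deg A v) 2 (suc k) ⟨
    deg A v + 2 + suc k           ∎))
    where open ≤-Reasoning

  ∣W∣+∣A′∣≡h : count W + count A′ ≡ h
  ∣W∣+∣A′∣≡h = trans (≡.sym (count-split A HighB)) ∣A∣≡h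

  partition : ∀ v → v ∈ B ⊎ v ∈ W ⊎ v ∈ A′
  partition v with A v in v∈A | HighB v in v∈HighB
  ... | false | _     = inj₁ (mem (cong not v∈A))
  ... | true  | true  = inj₂ (inj₁ (∩⁺ {X = A} {Y = HighB} (mem v∈A) (mem v∈HighB)))
  ... | true  | false = inj₂ (inj₂ (∩⁺ {X = A} {Y = ∁ HighB} (mem v∈A) (mem (cong not v∈HighB))))

  A′-deg-W : ∀ {v} → v ∈ A′ → count W ≤ deg W v + 1
  A′-deg-W {v} v∈A′ = ≤-trans (count≤deg+nondeg {X = W} {Y = W} {v = v} (λ _ p → p)) (+-monoʳ-≤ (deg W v) nondeg≤1)
    where
    v∉W : v ∉ W
    v∉W = ¬∈⇒∉ λ v∈W → ∈⇒∉⇒⊥ (∩⁻ʳ {X = A} v∈W) (∩⁻ʳ {X = A} v∈A′)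
    nondeg≤1 : nondeg W v ≤ 1
    nondeg≤1 = ≤-pred (≤-trans (nondeg-self W⊆A v∉W (A′⊆A v v∈A′)) (A′-nondeg v∈A′))

  shrink-B : ∀ {X u m j} → X ⊆ B → u ∈ B → m ≤ count X + j → m ≤ count (X ∩ Γ u) + (3 + j)
  shrink-B {X} {u} {m} {j} X⊆B u∈B m≤ = ≤-trans m≤ (≤-trans (+-monoˡ-≤ j
    (≤-trans (count≤deg+nondeg X⊆B) (+-monoʳ-≤ (deg X u) (B-nondeg u∈B)))) (≤-reflexive (+-assoc (deg X u) 3 j)))

  shrink-A′ : ∀ {X u m j} → X ⊆ A → u ∈ A′ → m ≤ count X + j → m ≤ count (X ∩ Γ u) + (2 + j)
  shrink-A′ {X} {u} {m} {j} X⊆A u∈A′ m≤ = ≤-trans m≤ (≤-trans (+-monoˡ-≤ j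
    (≤-trans (count≤deg+nondeg X⊆A) (+-monoʳ-≤ (deg X u) (A′-nondeg u∈A′)))) (≤-reflexive (+-assoc (deg X u) 2 j)))

  large⇒r≤ : ∀ {x j} → j ≤ 9 → h ≤ x + j → r ≤ x
  large⇒r≤ {x} {j} j≤9 h≤ = +-cancelʳ-≤ 9 r x (≤-trans r+9≤ (≤-trans large (≤-trans h≤ (+-monoʳ-≤ x j≤9))))
    where
    r+9≤ : r + 9 ≤ 5 * k + 30
    r+9≤ = subst (r + 9 ≤_) (e k) (m≤m+n (r + 9) (4 * k + 17))
      where
      e : ∀ k → 4 + k + 9 + (4 * k + 17) ≡ 5 * k + 30
      e = solve-∀

  large⇒∃ : ∀ {X : VSet n} {j} → j ≤ 9 → h ≤ count X + j → ∃ (_∈ X)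
  large⇒∃ {X} {j} j≤9 h≤ = count>0⇒∃ {X = X} (≤-trans (s≤s z≤n) (large⇒r≤ {count X} {j} j≤9 h≤))

  PercolatingSetOfSizeR : Set
  PercolatingSetOfSizeR = ∃ λ (P : Subset n) → ∣ P ∣ ≡ r × Percolates G r P

  module Seeded (S : VSet n) where
    open Bootstrap G r S public

    percolating-set : ∀ {t} → count S ≡ r → All (Infected t) B → All (Infected t) A′ → PercolatingSetOfSizeR
    percolating-set {t} ∣S∣≡r B-inf A′-inf = tabulate S , ∣tabulate∣≡r , percolates {suc t} everything
      where
      ∣tabulate∣≡r : ∣ tabulate S ∣ ≡ r
      ∣tabulate∣≡r = trans (∣p∣≡count (tabulate S)) (trans (count-cong (lookup∘tabulate S)) ∣S∣≡r)
      everything : ∀ v → Infected (suc t) v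
      everything v with partition v
      ... | inj₁ v∈B         = infected-suc {t} (B-inf v v∈B)
      ... | inj₂ (inj₁ v∈W)  = infect {t} B-inf (W-deg-B v∈W)
      ... | inj₂ (inj₂ v∈A′) = infected-suc {t} (A′-inf v v∈A′)

  module ThreeInW (3≤∣W∣ : 3 ≤ count W) where

    h≤∣B∣+0 : h ≤ count B + 0
    h≤∣B∣+0 = subst (h ≤_) (≡.sym (+-identityʳ (count B))) h≤∣B∣

    b₁-witness : ∃ (_∈ B)
    b₁-witness = large⇒∃ z≤n h≤∣B∣+0

    b₁ : Fin n
    b₁ = proj₁ b₁-witness

    b₁∈B : b₁ ∈ B
    b₁∈B = proj₂ b₁-witness

    h≤∣B∩Γb₁∣+3 : h ≤ count (B ∩ Γ b₁) + 3
    h≤∣B∩Γb₁∣+3 = shrink-B (λ _ p → p) b₁∈B h≤∣B∣+0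

    b₂-witness : ∃ (_∈ B ∩ Γ b₁)
    b₂-witness = large⇒∃ (+-monoʳ-≤ 3 z≤n) h≤∣B∩Γb₁∣+3

    b₂ : Fin n
    b₂ = proj₁ b₂-witness

    b₂∈B∩Γb₁ : b₂ ∈ B ∩ Γ b₁
    b₂∈B∩Γb₁ = proj₂ b₂-witness

    h≤∣B∩Γb₁∩Γb₂∣+6 : h ≤ count (B ∩ Γ b₁ ∩ Γ b₂) + 6
    h≤∣B∩Γb₁∩Γb₂∣+6 = shrink-B (λ _ → ∩⁻ˡ) (∩⁻ˡ b₂∈B∩Γb₁) h≤∣B∩Γb₁∣+3

    b₃-witness : ∃ (_∈ B ∩ Γ b₁ ∩ Γ b₂)
    b₃-witness = large⇒∃ (+-monoʳ-≤ 6 z≤n) h≤∣B∩Γb₁∩Γb₂∣+6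

    b₃ : Fin n
    b₃ = proj₁ b₃-witness

    b₃∈B∩Γb₁∩Γb₂ : b₃ ∈ B ∩ Γ b₁ ∩ Γ b₂
    b₃∈B∩Γb₁∩Γb₂ = proj₂ b₃-witness

    C : VSet n
    C = B ∩ Γ b₁ ∩ Γ b₂ ∩ Γ b₃

    r≤∣C∣ : r ≤ count C
    r≤∣C∣ = large⇒r≤ ≤-refl (shrink-B (λ _ p → ∩⁻ˡ (∩⁻ˡ p)) (∩⁻ˡ (∩⁻ˡ b₃∈B∩Γb₁∩Γb₂)) h≤∣B∩Γb₁∩Γb₂∣+6)

    S-witness : ∃ λ S → S ⊆ C × count S ≡ r
    S-witness = ∃⊆-count r r≤∣C∣

    S : VSet n
    S = proj₁ S-witness

    S⊆C : S ⊆ C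
    S⊆C = proj₁ (proj₂ S-witness)

    ∣S∣≡r : count S ≡ r
    ∣S∣≡r = proj₂ (proj₂ S-witness)

    S⊆B : S ⊆ B
    S⊆B i i∈S = ∩⁻ˡ (∩⁻ˡ (∩⁻ˡ (S⊆C i i∈S)))

    S⊆Γb₁ : S ⊆ Γ b₁
    S⊆Γb₁ i i∈S = ∩⁻ʳ {X = B} (∩⁻ˡ (∩⁻ˡ (S⊆C i i∈S)))

    S⊆Γb₂ : S ⊆ Γ b₂
    S⊆Γb₂ i i∈S = ∩⁻ʳ {X = B ∩ Γ b₁} (∩⁻ˡ (S⊆C i i∈S))

    S⊆Γb₃ : S ⊆ Γ b₃
    S⊆Γb₃ i i∈S = ∩⁻ʳ (S⊆C i i∈S)

    open Seeded S

    adjacent-to-S⇒at-1 : ∀ {b} → S ⊆ Γ b → Infected 1 b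
    adjacent-to-S⇒at-1 {b} S⊆Γb = infect {0} seed-infected (subst (_≤ deg S b) ∣S∣≡r (count≤deg S⊆Γb))

    X : VSet n
    X = S ∪ ⁅ b₁ ⁆ ∪ ⁅ b₂ ⁆ ∪ ⁅ b₃ ⁆

    X⊆B : X ⊆ B
    X⊆B = All-∪⁅⁆ (All-∪⁅⁆ (All-∪⁅⁆ S⊆B b₁∈B) (∩⁻ˡ b₂∈B∩Γb₁)) (∩⁻ˡ (∩⁻ˡ b₃∈B∩Γb₁∩Γb₂))

    X-at-1 : All (Infected 1) X
    X-at-1 = All-∪⁅⁆ (All-∪⁅⁆ (All-∪⁅⁆ (λ i → infected-suc {0} ∘ seed-infected i)
      (adjacent-to-S⇒at-1 S⊆Γb₁)) (adjacent-to-S⇒at-1 S⊆Γb₂)) (adjacent-to-S⇒at-1 S⊆Γb₃)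

    ∣X∣≡r+3 : count X ≡ r + 1 + 1 + 1
    ∣X∣≡r+3 = begin
      count X                              ≡⟨ count-∪⁅⁆ b₃∉ ⟩
      count (S ∪ ⁅ b₁ ⁆ ∪ ⁅ b₂ ⁆) + 1      ≡⟨ cong (_+ 1) (count-∪⁅⁆ b₂∉) ⟩
      count (S ∪ ⁅ b₁ ⁆) + 1 + 1           ≡⟨ cong (λ c → c + 1 + 1) (count-∪⁅⁆ b₁∉) ⟩
      count S + 1 + 1 + 1                  ≡⟨ cong (λ c → c + 1 + 1 + 1) ∣S∣≡r ⟩
      r + 1 + 1 + 1                        ∎
      where
      open ≡-Reasoning
      b₁∉ : b₁ ∉ S
      b₁∉ = ⊆Γ⇒∉ S⊆Γb₁
      b₂∉ : b₂ ∉ S ∪ ⁅ b₁ ⁆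
      b₂∉ = ⊆Γ⇒∉ (All-∪⁅⁆ S⊆Γb₂ (Γ-sym (∩⁻ʳ b₂∈B∩Γb₁)))
      b₃∉ : b₃ ∉ S ∪ ⁅ b₁ ⁆ ∪ ⁅ b₂ ⁆
      b₃∉ = ⊆Γ⇒∉ (All-∪⁅⁆ (All-∪⁅⁆ S⊆Γb₃ (Γ-sym (∩⁻ʳ {X = B} (∩⁻ˡ b₃∈B∩Γb₁∩Γb₂)))) (Γ-sym (∩⁻ʳ b₃∈B∩Γb₁∩Γb₂)))

    B-at-2 : All (Infected 2) B
    B-at-2 v v∈B = absorb {1} X⊆B X-at-1 v∈B (B-nondeg v∈B) (≤-trans (≤-reflexive r+3≡∣X∣) (n≤1+n (count X)))
      where
      e : ∀ r → r + 3 ≡ r + 1 + 1 + 1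
      e = solve-∀
      r+3≡∣X∣ : r + 3 ≡ count X
      r+3≡∣X∣ = trans (e r) (≡.sym ∣X∣≡r+3)

    W-at-3 : All (Infected 3) W
    W-at-3 v v∈W = infect {2} B-at-2 (W-deg-B v∈W)

    A′-at-4 : All (Infected 4) A′
    A′-at-4 v v∈A′ = infect {3} (All-∪ (λ i → infected-suc {2} ∘ B-at-2 i) W-at-3) (begin
      r                  ≡⟨ +-comm 2 (2 + k) ⟩
      2 + k + 2          ≤⟨ +-mono-≤ (A-deg-B (A′⊆A v v∈A′)) 2≤deg-W ⟩
      deg B v + deg W v  ≡⟨ deg-∪ (λ i i∈W → ∈⇒∉∁ (W⊆A i i∈W)) ⟨
      deg (B ∪ W) v      ∎)
      where
      open ≤-Reasoning
      2≤deg-W : 2 ≤ deg W v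
      2≤deg-W = +-cancelʳ-≤ 1 2 (deg W v) (≤-trans 3≤∣W∣ (A′-deg-W v∈A′))

    percolating : PercolatingSetOfSizeR
    percolating = percolating-set {4} ∣S∣≡r (λ v → infected-mono {2} {4} (s≤s (s≤s z≤n)) ∘ B-at-2 v) A′-at-4

  module AtMostTwoInW (∣W∣≤2 : count W ≤ 2) where

    h≤∣A′∣+2 : h ≤ count A′ + 2
    h≤∣A′∣+2 = subst₂ _≤_ ∣W∣+∣A′∣≡h (+-comm 2 (count A′)) (+-monoˡ-≤ (count A′) ∣W∣≤2)

    5k+28≤∣A′∣ : 5 * k + 28 ≤ count A′
    5k+28≤∣A′∣ = +-cancelʳ-≤ 2 _ _ (≤-trans (≤-reflexive (+-assoc (5 * k) 28 2)) (≤-trans large h≤∣A′∣+2))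

    ∣B∣≤∣A′∣+3 : count B ≤ count A′ + 3
    ∣B∣≤∣A′∣+3 = ≤-trans ∣B∣≤1+h (≤-trans (s≤s h≤∣A′∣+2) (≤-reflexive (≡.sym (+-suc (count A′) 2))))

    B-deg-A′ : ∀ {b} → b ∈ B → deg A′ b ≤ 3 + k
    B-deg-A′ b∈B = ≤-trans (deg-mono A′⊆A) (B-deg-A b∈B)

    AtLeast : ℕ → VSet n
    AtLeast m = setOf (λ b → m ≤? deg A′ b)

    ∣B∣-split : ∀ m → count (B ∩ ∁ (AtLeast m)) + count (B ∩ AtLeast m) ≤ count A′ + 3
    ∣B∣-split m =
      subst (_≤ count A′ + 3) (trans (count-split B (AtLeast m)) (+-comm (count (B ∩ AtLeast m)) _)) ∣B∣≤∣A′∣+3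

    edges-A′-B : ∀ {m} → count A′ * (2 + k) ≤ edges (B ∩ AtLeast m) A′ + edges (B ∩ ∁ (AtLeast m)) A′
    edges-A′-B {m} = subst (count A′ * (2 + k) ≤_) (trans (edges-comm A′ B) (edges-split B A′ (AtLeast m)))
      (edges≥ λ v v∈A′ → A-deg-B (A′⊆A v v∈A′))

    edges-above : ∀ m → edges (B ∩ AtLeast m) A′ ≤ count (B ∩ AtLeast m) * (3 + k)
    edges-above m = edges≤ λ b b∈ → B-deg-A′ (∩⁻ˡ b∈)

    edges-below : ∀ l → edges (B ∩ ∁ (AtLeast (suc l))) A′ ≤ count (B ∩ ∁ (AtLeast (suc l))) * l
    edges-below l = edges≤ λ b b∈ → ≤-pred (≰⇒> (setOf-∉⁻ (λ b → suc l ≤? deg A′ b) (∩⁻ʳ {X = B} b∈)))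

    B₂ : VSet n
    B₂ = B ∩ AtLeast 2

    many-edges-to-B₂ : count A′ < edges A′ B₂
    many-edges-to-B₂ = many-edges-into-high-part A′-edges≤ (∣B∣-split 2) L≤ 5k+28≤∣A′∣
      where
      open ≤-Reasoning
      L≤ : edges A′ B₂ ≤ count B₂ * (3 + k)
      L≤ = subst (_≤ count B₂ * (3 + k)) (edges-comm B₂ A′) (edges-above 2)
      A′-edges≤ : count A′ * (2 + k) ≤ count (B ∩ ∁ (AtLeast 2)) + edges A′ B₂
      A′-edges≤ = begin
        count A′ * (2 + k)                                  ≤⟨ edges-A′-B ⟩
        edges B₂ A′ + edges (B ∩ ∁ (AtLeast 2)) A′            ≤⟨ +-monoʳ-≤ (edges B₂ A′) (edges-below 1) ⟩
        edges B₂ A′ + count (B ∩ ∁ (AtLeast 2)) * 1           ≡⟨ cong₂ _+_ (edges-comm B₂ A′) (*-identityʳ _) ⟩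
        edges A′ B₂ + count (B ∩ ∁ (AtLeast 2))               ≡⟨ +-comm (edges A′ B₂) _ ⟩
        count (B ∩ ∁ (AtLeast 2)) + edges A′ B₂               ∎

    k+12≤∣B∩AtLeast[2+k]∣ : k + 12 ≤ count (B ∩ AtLeast (2 + k))
    k+12≤∣B∩AtLeast[2+k]∣ = large-high-part A′-edges≤ (∣B∣-split (2 + k)) 5k+28≤∣A′∣
      where
      A′-edges≤ : count A′ * (2 + k) ≤ count (B ∩ ∁ (AtLeast (2 + k))) * (1 + k) + count (B ∩ AtLeast (2 + k)) * (3 + k)
      A′-edges≤ = ≤-trans edges-A′-B (≤-trans (+-mono-≤ (edges-above (2 + k)) (edges-below (1 + k)))
                                              (≤-reflexive (+-comm (count (B ∩ AtLeast (2 + k)) * (3 + k)) _)))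

    t₁-witness : ∃ λ t → t ∈ A′ × 2 ≤ deg B₂ t
    t₁-witness = count<edges⇒∃ many-edges-to-B₂

    t₁ : Fin n
    t₁ = proj₁ t₁-witness

    t₁∈A′ : t₁ ∈ A′
    t₁∈A′ = proj₁ (proj₂ t₁-witness)

    t₁∈A : t₁ ∈ A
    t₁∈A = A′⊆A t₁ t₁∈A′

    module _ {b} (b∈ : b ∈ B₂ ∩ Γ t₁) where
      ∈B₂∩Γt₁⇒∈B : b ∈ B
      ∈B₂∩Γt₁⇒∈B = ∩⁻ˡ (∩⁻ˡ b∈)

      ∈B₂∩Γt₁⇒∈Γt₁ : b ∈ Γ t₁
      ∈B₂∩Γt₁⇒∈Γt₁ = ∩⁻ʳ {X = B₂} b∈

      ∈B₂∩Γt₁⇒1≤deg : 1 ≤ deg (A′ ∖ t₁) b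
      ∈B₂∩Γt₁⇒1≤deg = +-cancelʳ-≤ 1 1 _ (≤-trans 2≤deg (deg≤deg-∖+1 A′ t₁ b))
        where
        2≤deg : 2 ≤ deg A′ b
        2≤deg = setOf⁻ (λ b → 2 ≤? deg A′ b) (∩⁻ʳ {X = B} (∩⁻ˡ b∈))

    b₁-witness : ∃ (_∈ B₂ ∩ Γ t₁)
    b₁-witness = count>0⇒∃ {X = B₂ ∩ Γ t₁} (≤-trans (s≤s z≤n) (proj₂ (proj₂ t₁-witness)))

    b₁ : Fin n
    b₁ = proj₁ b₁-witness

    b₁∈ : b₁ ∈ B₂ ∩ Γ t₁
    b₁∈ = proj₂ b₁-witness

    b₂-witness : ∃ (_∈ B₂ ∩ Γ t₁ ∖ b₁)
    b₂-witness = count>0⇒∃ {X = B₂ ∩ Γ t₁ ∖ b₁}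
      (≤-pred (≤-trans (proj₂ (proj₂ t₁-witness)) (≤-reflexive (≡.sym (count-∖ b₁∈)))))

    b₂ : Fin n
    b₂ = proj₁ b₂-witness

    b₂∈ : b₂ ∈ B₂ ∩ Γ t₁
    b₂∈ = ∩⁻ˡ (proj₂ b₂-witness)

    b₂∉⁅b₁⁆ : b₂ ∉ ⁅ b₁ ⁆
    b₂∉⁅b₁⁆ = ∩⁻ʳ {X = B₂ ∩ Γ t₁} (proj₂ b₂-witness)

    Q : VSet n
    Q = ⁅ b₁ ⁆ ∪ ⁅ b₂ ⁆

    Q⊆B : Q ⊆ B
    Q⊆B = All-∪⁅⁆ (All-⁅⁆ (∈B₂∩Γt₁⇒∈B b₁∈)) (∈B₂∩Γt₁⇒∈B b₂∈)

    ∣Q∣≡2 : count Q ≡ 2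
    ∣Q∣≡2 = trans (count-∪⁅⁆ b₂∉⁅b₁⁆) (cong (_+ 1) (count-⁅⁆ b₁))

    Disjoint-Q : ∀ {X} → X ⊆ A → Disjoint X Q
    Disjoint-Q X⊆A i i∈Q = ¬∈⇒∉ λ i∈X → ∈⇒∉⇒⊥ (X⊆A i i∈X) (Q⊆B i i∈Q)

    T : VSet n
    T = ⁅ t₁ ⁆ ∪ Q

    many-edges-to-T : count (A′ ∖ t₁) < edges (A′ ∖ t₁) T
    many-edges-to-T = begin-strict
      count (A′ ∖ t₁)
        <⟨ ≤-reflexive (count-∖ t₁∈A′) ⟩
      count A′
        ≤⟨ count≤deg+nondeg {v = t₁} A′⊆A ⟩
      deg A′ t₁ + nondeg A t₁
        ≤⟨ +-mono-≤ (deg≤deg-∖self A′ t₁) (A′-nondeg t₁∈A′) ⟩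
      deg (A′ ∖ t₁) t₁ + 2
        ≤⟨ +-monoʳ-≤ (deg (A′ ∖ t₁) t₁) (+-mono-≤ (∈B₂∩Γt₁⇒1≤deg b₁∈) (∈B₂∩Γt₁⇒1≤deg b₂∈)) ⟩
      deg (A′ ∖ t₁) t₁ + (deg (A′ ∖ t₁) b₁ + deg (A′ ∖ t₁) b₂)
        ≡⟨ edges-T ⟨
      edges (A′ ∖ t₁) T
        ∎
      where
      open ≤-Reasoning
      edges-T : edges (A′ ∖ t₁) T ≡ deg (A′ ∖ t₁) t₁ + (deg (A′ ∖ t₁) b₁ + deg (A′ ∖ t₁) b₂)
      edges-T = begin-equality
        edges (A′ ∖ t₁) T
          ≡⟨ edges-comm (A′ ∖ t₁) T ⟩
        edges T (A′ ∖ t₁)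
          ≡⟨ edges-∪ (A′ ∖ t₁) (λ i i∈Q → ∈⇒∉⇒∉⁅⁆ (Q⊆B i i∈Q) (∈⇒∉∁ t₁∈A)) ⟩
        edges ⁅ t₁ ⁆ (A′ ∖ t₁) + edges Q (A′ ∖ t₁)
          ≡⟨ cong (edges ⁅ t₁ ⁆ (A′ ∖ t₁) +_) (edges-∪ (A′ ∖ t₁) (All-⁅⁆ b₂∉⁅b₁⁆)) ⟩
        edges ⁅ t₁ ⁆ (A′ ∖ t₁) + (edges ⁅ b₁ ⁆ (A′ ∖ t₁) + edges ⁅ b₂ ⁆ (A′ ∖ t₁))
          ≡⟨ cong₂ _+_ (edges-⁅⁆ t₁ (A′ ∖ t₁)) (cong₂ _+_ (edges-⁅⁆ b₁ (A′ ∖ t₁)) (edges-⁅⁆ b₂ (A′ ∖ t₁))) ⟩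
        deg (A′ ∖ t₁) t₁ + (deg (A′ ∖ t₁) b₁ + deg (A′ ∖ t₁) b₂)
          ∎

    t₂-witness : ∃ λ t → t ∈ A′ ∖ t₁ × 2 ≤ deg T t
    t₂-witness = count<edges⇒∃ many-edges-to-T

    t₂ : Fin n
    t₂ = proj₁ t₂-witness

    t₂∈A′ : t₂ ∈ A′
    t₂∈A′ = ∩⁻ˡ (proj₁ (proj₂ t₂-witness))

    t₂∉⁅t₁⁆ : t₂ ∉ ⁅ t₁ ⁆
    t₂∉⁅t₁⁆ = ∩⁻ʳ {X = A′} (proj₁ (proj₂ t₂-witness))

    h≤∣A′∩Γt₁∩Γt₂∣+6 : h ≤ count (A′ ∩ Γ t₁ ∩ Γ t₂) + 6
    h≤∣A′∩Γt₁∩Γt₂∣+6 = shrink-A′ (λ _ p → A′⊆A _ (∩⁻ˡ p)) t₂∈A′ (shrink-A′ A′⊆A t₁∈A′ h≤∣A′∣+2)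

    t₃-witness : ∃ (_∈ A′ ∩ Γ t₁ ∩ Γ t₂)
    t₃-witness = large⇒∃ (+-monoʳ-≤ 6 z≤n) h≤∣A′∩Γt₁∩Γt₂∣+6

    t₃ : Fin n
    t₃ = proj₁ t₃-witness

    t₃∈ : t₃ ∈ A′ ∩ Γ t₁ ∩ Γ t₂
    t₃∈ = proj₂ t₃-witness

    C : VSet n
    C = A′ ∩ Γ t₁ ∩ Γ t₂ ∩ Γ t₃

    2+k≤∣C∣ : 2 + k ≤ count C
    2+k≤∣C∣ = ≤-trans (+-monoˡ-≤ k (s≤s (s≤s z≤n)))
      (large⇒r≤ (+-monoʳ-≤ 8 z≤n) (shrink-A′ (λ _ p → A′⊆A _ (∩⁻ˡ (∩⁻ˡ p))) (∩⁻ˡ (∩⁻ˡ t₃∈)) h≤∣A′∩Γt₁∩Γt₂∣+6))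

    S-witness : ∃ λ S → S ⊆ C × count S ≡ 2 + k
    S-witness = ∃⊆-count (2 + k) 2+k≤∣C∣

    S : VSet n
    S = proj₁ S-witness

    S⊆C : S ⊆ C
    S⊆C = proj₁ (proj₂ S-witness)

    ∣S∣≡2+k : count S ≡ 2 + k
    ∣S∣≡2+k = proj₂ (proj₂ S-witness)

    S⊆A : S ⊆ A
    S⊆A i i∈S = A′⊆A i (∩⁻ˡ (∩⁻ˡ (∩⁻ˡ (S⊆C i i∈S))))

    S⊆Γt₁ : S ⊆ Γ t₁
    S⊆Γt₁ i i∈S = ∩⁻ʳ {X = A′} (∩⁻ˡ (∩⁻ˡ (S⊆C i i∈S)))

    S⊆Γt₂ : S ⊆ Γ t₂
    S⊆Γt₂ i i∈S = ∩⁻ʳ {X = A′ ∩ Γ t₁} (∩⁻ˡ (S⊆C i i∈S))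

    S⊆Γt₃ : S ⊆ Γ t₃
    S⊆Γt₃ i i∈S = ∩⁻ʳ (S⊆C i i∈S)

    P : VSet n
    P = S ∪ Q

    ∣P∣≡r : count P ≡ r
    ∣P∣≡r = trans (count-∪ (Disjoint-Q S⊆A)) (trans (cong₂ _+_ ∣S∣≡2+k ∣Q∣≡2) (+-comm (2 + k) 2))

    Bᵏ : VSet n
    Bᵏ = B ∩ AtLeast (2 + k)

    D : VSet n
    D = Bᵏ ∩ Γ b₁ ∩ Γ b₂

    k+6≤∣D∣ : k + 6 ≤ count D
    k+6≤∣D∣ = +-cancelʳ-≤ 6 (k + 6) (count D) (≤-trans (≤-reflexive (+-assoc k 6 6))
      (shrink-B (λ _ p → ∩⁻ˡ (∩⁻ˡ p)) (∈B₂∩Γt₁⇒∈B b₂∈) (shrink-B {j = 0} (λ _ → ∩⁻ˡ) (∈B₂∩Γt₁⇒∈B b₁∈)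
        (subst (k + 12 ≤_) (≡.sym (+-identityʳ _)) k+12≤∣B∩AtLeast[2+k]∣))))

    open Seeded P

    S-at : ∀ t → All (Infected t) S
    S-at t i = infected-mono {0} {t} z≤n ∘ seed-infected i ∘ ∪⁺ˡ

    Q-at : ∀ t → All (Infected t) Q
    Q-at t i = infected-mono {0} {t} z≤n ∘ seed-infected i ∘ ∪⁺ʳ {X = S}

    t₁-at-1 : Infected 1 t₁
    t₁-at-1 = infect {0} seed-infected (subst (_≤ deg P t₁) ∣P∣≡r (count≤deg (All-∪ S⊆Γt₁ Q⊆Γt₁)))
      where
      Q⊆Γt₁ : Q ⊆ Γ t₁
      Q⊆Γt₁ = All-∪⁅⁆ (All-⁅⁆ (∈B₂∩Γt₁⇒∈Γt₁ b₁∈)) (∈B₂∩Γt₁⇒∈Γt₁ b₂∈)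

    t₂-at-2 : Infected 2 t₂
    t₂-at-2 = infect {1} {S ∪ T} (All-∪ (S-at 1) (All-∪ (All-⁅⁆ t₁-at-1) (Q-at 1))) (begin
      r                    ≡⟨ +-comm 2 (2 + k) ⟩
      2 + k + 2            ≤⟨ +-mono-≤ (subst (_≤ deg S t₂) ∣S∣≡2+k (count≤deg S⊆Γt₂)) (proj₂ (proj₂ t₂-witness)) ⟩
      deg S t₂ + deg T t₂  ≡⟨ deg-∪ (All-∪ (All-⁅⁆ (⊆Γ⇒∉ S⊆Γt₁)) (Disjoint-Q S⊆A)) ⟨
      deg (S ∪ T) t₂       ∎)
      where open ≤-Reasoning

    X₃ : VSet n
    X₃ = S ∪ ⁅ t₁ ⁆ ∪ ⁅ t₂ ⁆

    X₃⊆Γt₃ : X₃ ⊆ Γ t₃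
    X₃⊆Γt₃ = All-∪⁅⁆ (All-∪⁅⁆ S⊆Γt₃ (Γ-sym (∩⁻ʳ {X = A′} (∩⁻ˡ t₃∈)))) (Γ-sym (∩⁻ʳ t₃∈))

    ∣X₃∣≡r : count X₃ ≡ r
    ∣X₃∣≡r = begin
      count X₃                ≡⟨ count-∪⁅⁆ (∉-∪ (⊆Γ⇒∉ S⊆Γt₂) t₂∉⁅t₁⁆) ⟩
      count (S ∪ ⁅ t₁ ⁆) + 1  ≡⟨ cong (_+ 1) (count-∪⁅⁆ (⊆Γ⇒∉ S⊆Γt₁)) ⟩
      count S + 1 + 1         ≡⟨ cong (λ c → c + 1 + 1) ∣S∣≡2+k ⟩
      2 + k + 1 + 1           ≡⟨ e k ⟩
      r                       ∎
      where
      open ≡-Reasoning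
      e : ∀ k → 2 + k + 1 + 1 ≡ 4 + k
      e = solve-∀

    t₃-at-3 : Infected 3 t₃
    t₃-at-3 = infect {2} {X₃} (All-∪⁅⁆ (All-∪⁅⁆ (S-at 2) (infected-suc {1} t₁-at-1)) t₂-at-2)
      (subst (_≤ deg X₃ t₃) ∣X₃∣≡r (count≤deg X₃⊆Γt₃))

    X₄ : VSet n
    X₄ = X₃ ∪ ⁅ t₃ ⁆

    X₄⊆A : X₄ ⊆ A
    X₄⊆A = All-∪⁅⁆ (All-∪⁅⁆ (All-∪⁅⁆ S⊆A t₁∈A) (A′⊆A t₂ t₂∈A′)) (A′⊆A t₃ (∩⁻ˡ (∩⁻ˡ t₃∈)))

    X₄-at-3 : All (Infected 3) X₄
    X₄-at-3 = All-∪⁅⁆ (All-∪⁅⁆ (All-∪⁅⁆ (S-at 3) (infected-mono {1} {3} (s≤s z≤n) t₁-at-1))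
                                 (infected-suc {2} t₂-at-2)) t₃-at-3

    ∣X₄∣≡r+1 : count X₄ ≡ r + 1
    ∣X₄∣≡r+1 = trans (count-∪⁅⁆ (⊆Γ⇒∉ X₃⊆Γt₃)) (cong (_+ 1) ∣X₃∣≡r)

    A′-at-4 : All (Infected 4) A′
    A′-at-4 v v∈A′ = absorb {3} X₄⊆A X₄-at-3 (A′⊆A v v∈A′) (A′-nondeg v∈A′)
      (≤-reflexive (trans (+-suc r 1) (cong suc (≡.sym ∣X₄∣≡r+1))))

    D-at-5 : All (Infected 5) D
    D-at-5 d d∈D = infect {4} {A′ ∪ Q} (All-∪ A′-at-4 (Q-at 4)) (begin
      r                   ≡⟨ +-comm 2 (2 + k) ⟩
      2 + k + 2           ≤⟨ +-mono-≤ 2+k≤deg (subst (_≤ deg Q d) ∣Q∣≡2 (count≤deg Q⊆Γd)) ⟩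
      deg A′ d + deg Q d  ≡⟨ deg-∪ (Disjoint-Q A′⊆A) ⟨
      deg (A′ ∪ Q) d      ∎)
      where
      open ≤-Reasoning
      2+k≤deg : 2 + k ≤ deg A′ d
      2+k≤deg = setOf⁻ (λ b → 2 + k ≤? deg A′ b) (∩⁻ʳ {X = B} (∩⁻ˡ (∩⁻ˡ d∈D)))
      Q⊆Γd : Q ⊆ Γ d
      Q⊆Γd = All-∪⁅⁆ (All-⁅⁆ (Γ-sym (∩⁻ʳ {X = Bᵏ} (∩⁻ˡ d∈D)))) (Γ-sym (∩⁻ʳ d∈D))

    B-at-6 : All (Infected 6) B
    B-at-6 v v∈B = absorb {5} {D} (λ i i∈D → ∩⁻ˡ (∩⁻ˡ (∩⁻ˡ i∈D))) D-at-5 v∈B (B-nondeg v∈B)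
      (≤-trans (≤-reflexive (e k)) (s≤s k+6≤∣D∣))
      where
      e : ∀ k → 4 + k + 3 ≡ suc (k + 6)
      e = solve-∀

    percolating : PercolatingSetOfSizeR
    percolating = percolating-set {6} ∣P∣≡r B-at-6 (λ v → infected-mono {4} {6} (+-monoʳ-≤ 4 z≤n) ∘ A′-at-4 v)

  percolating-set-of-size-r : PercolatingSetOfSizeR
  percolating-set-of-size-r with 3 ≤? count W
  ... | yes 3≤∣W∣ = ThreeInW.percolating 3≤∣W∣
  ... | no  3≰∣W∣ = AtMostTwoInW.percolating (≤-pred (≰⇒> 3≰∣W∣))

ClosureEq⇒infected⇒∈ : ∀ {n} (G : Graph n) r (A : Subset n) → ClosureEq G r A →
                       ∀ {t v} → Bootstrap.Infected G r (lookup A) t v → v ∈ lookup A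
ClosureEq⇒infected⇒∈ G r A (closure⊆A , _) {t} {v} (mem p) =
  mem ([]=⇒lookup (closure⊆A v (t , lookup⇒[]= v (stage G r A t) v∈Aₜ)))
  where
  v∈Aₜ : lookup (stage G r A t) v ≡ true
  v∈Aₜ = subst (λ A′ → lookup (stage G r A′ t) v ≡ true) (tabulate∘lookup A) p

proposition4p5 : ∀ (r : ℕ) → 4 ≤ r → ∃ λ (n₀ : ℕ) → ∀ (n : ℕ) → n₀ ≤ n → (G : Graph n) → MinDegreeAtLeast G (n / 2 + (r ∸ 3)) → (∃ λ (A : Subset n) → ∣ A ∣ ≡ n / 2 × ClosureEq G r A) → MEquals G r r
proposition4p5 .(4 + k) (s≤s (s≤s (s≤s (s≤s {n = k} _)))) = (5 * k + 30) * 2 , main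
  where
  main : ∀ n → (5 * k + 30) * 2 ≤ n → (G : Graph n) → MinDegreeAtLeast G (n / 2 + suc k) →
         (∃ λ (A : Subset n) → ∣ A ∣ ≡ n / 2 × ClosureEq G (4 + k) A) → MEquals G (4 + k) (4 + k)
  main n n₀≤n G mindeg (A , ∣A∣≡h , closed) = percolating-set-of-size-r , percolating⇒r≤∣P∣ G (4 + k) r≤n
    where
    large : 5 * k + 30 ≤ n / 2
    large = subst (_≤ n / 2) (m*n/n≡m (5 * k + 30) 2) (/-monoˡ-≤ 2 n₀≤n)
    r≤n : 4 + k ≤ n
    r≤n = ≤-trans (subst (4 + k ≤_) (e k) (m≤n+m (4 + k) (4 * k + 26))) (≤-trans (m≤m*n (5 * k + 30) 2) n₀≤n)
      where
      e : ∀ k → 4 * k + 26 + (4 + k) ≡ 5 * k + 30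
      e = solve-∀
    open ClosedHalf G k (lookup A) mindeg (trans (≡.sym (∣p∣≡count A)) ∣A∣≡h)
                 (λ {t} → ClosureEq⇒infected⇒∈ G (4 + k) A closed {t}) large
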